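{- Let $G$ be a graph with a partial coloring $p: S\to[\ell]$, $S\subseteq V(G)$, and let $H\subseteq\mathcal{H}(G,p)$ be an arbitrary subset of its potentially happy vertices. Then there exists a coloring $c: V(G)\to[\ell]$ extending $p$ such that all vertices in $H$ are happy with respect to $c$ if and only if there exists no path $u_1,u_2,\dots,u_t$ in $G$ such that $u_1,u_t\in S$, $p(u_1)\neq p(u_t)$, and for each $i\in[t-1]$, $u_i\in H$ or $u_{i+1}\in H$.
   Context: All graphs are finite, simple and undirected; $[\ell]=\{1,\dots,\ell\}$. Given a coloring $c:V(G)\to[\ell]$, a vertex $v$ is happy if $c(u)=c(v)$ for every neighbour $u$ of $v$. A vertex $v$ of $G$ is potentially happy with respect to the partial coloring $p$ if there exists a coloring $c:V(G)\to[\ell]$ extending $p$ such that $v$ is happy with respect to $c$; $\mathcal{H}(G,p)$ denotes the set of potentially happy vertices. -}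

module Defs where

open import Data.Nat using (ℕ; suc)
open import Data.Fin using (Fin; inject₁) renaming (suc to fsuc)
open import Data.Fin.Subset using (Subset; _∈_)
open import Data.Maybe using (Maybe; just)
open import Data.Product using (Σ; ∃; _×_)
open import Data.Sum using (_⊎_)
open import Function.Definitions using (Injective)
open import Relation.Binary.PropositionalEquality using (_≡_)
open import Relation.Nullary using (¬_; Dec)

record Graph (n : ℕ) : Set₁ where
  field
    Adj    : Fin n → Fin n → Set
    adj?   : ∀ u v → Dec (Adj u v)
    sym    : ∀ {u v} → Adj u v → Adj v u
    irrefl : ∀ {u} → ¬ Adj u u
open Graph public

-- A partial coloring p : S → [ℓ], S ⊆ V(G); S = {v | p v ≡ just _}.
PartialColoring : ℕ → ℕ → Set
PartialColoring n ℓ = Fin n → Maybe (Fin ℓ)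

Coloring : ℕ → ℕ → Set
Coloring n ℓ = Fin n → Fin ℓ

Extends : ∀ {n ℓ} → Coloring n ℓ → PartialColoring n ℓ → Set
Extends c p = ∀ v k → p v ≡ just k → c v ≡ k

Happy : ∀ {n ℓ} → Graph n → Coloring n ℓ → Fin n → Set
Happy G c v = ∀ u → Adj G v u → c u ≡ c v

PotentiallyHappy : ∀ {n ℓ} → Graph n → PartialColoring n ℓ → Fin n → Set
PotentiallyHappy {n} {ℓ} G p v = Σ (Coloring n ℓ) λ c → Extends c p × Happy G c v

-- A path u₁,…,u_t (t = suc k ≥ 1) in G: distinct vertices, consecutive ones adjacent.
record Path {n : ℕ} (G : Graph n) : Set where
  field
    k        : ℕ
    vertex   : Fin (suc k) → Fin n
    distinct : Injective _≡_ _≡_ vertex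
    adjacent : ∀ (i : Fin k) → Adj G (vertex (inject₁ i)) (vertex (fsuc i))
open Path public

BadPath : ∀ {n ℓ} (G : Graph n) → PartialColoring n ℓ → Subset n → Path G → Set
BadPath {n} {ℓ} G p H P =
  (Σ (Fin ℓ) λ a → Σ (Fin ℓ) λ b →
     p (vertex P Data.Fin.zero) ≡ just a × p (vertex P (Data.Fin.fromℕ (k P))) ≡ just b × ¬ a ≡ b)
  × (∀ (i : Fin (k P)) → vertex P (inject₁ i) ∈ H ⊎ vertex P (fsuc i) ∈ H)

-- Call an edge an H-edge if one of its ends lies in H. A colouring with every vertex of H happy
-- is constant along H-edges, so it cannot exist when an H-walk joins two differently precoloured
-- vertices; shortening such a walk to a path gives exactly a bad path. Conversely, without bad
-- paths all precoloured vertices reachable by an H-walk from a given vertex share one colour;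
-- giving each vertex that colour (and an arbitrary colour when there is none) extends p and
-- makes every vertex of H happy. Reachability is decidable because a shortest walk has fewer
-- than n steps.
module Submission where

open import Defs
open import Level using (0ℓ)
open import Data.Nat using (ℕ; zero; suc; _≤_; _<_)
open import Data.Nat.Properties using (suc-injective)
open import Data.Fin using (Fin; inject₁; fromℕ; fromℕ<; toℕ; _≟_) renaming (zero to fzero; suc to fsuc)
open import Data.Fin.Properties using (any?; injective⇒≤; toℕ-fromℕ<)
open import Data.Fin.Subset using (Subset; _∈_)
open import Data.Fin.Subset.Properties using (_∈?_)
open import Data.Maybe using (just; nothing)
open import Data.Product using (Σ; ∃; _×_; _,_; proj₁; proj₂)
open import Data.Sum using (_⊎_; inj₁; inj₂)
open import Data.Unit using (⊤; tt)
open import Data.Empty using (⊥-elim)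
open import Function using (_∘_)
open import Function.Bundles using (_⇔_; mk⇔)
open import Function.Definitions using (Injective)
open import Relation.Binary.Core using (Rel)
open import Relation.Binary.Definitions using (Decidable; Symmetric)
open import Relation.Binary.Construct.Closure.ReflexiveTransitive using (Star; ε; _◅_; _◅◅_; reverse)
open import Relation.Nullary using (¬_; Dec; yes; no; contradiction)
open import Relation.Nullary.Decidable using (_×-dec_; _⊎-dec_)
open import Relation.Binary.PropositionalEquality using (_≡_; refl; trans; cong; subst) renaming (sym to ≡-sym)

first≡last : ∀ {A : Set} m (f : Fin (suc m) → A) →
             (∀ i → f (inject₁ i) ≡ f (fsuc i)) → f fzero ≡ f (fromℕ m)
first≡last zero    f step = refl
first≡last (suc m) f step = trans (step fzero) (first≡last m (f ∘ fsuc) (step ∘ fsuc))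

module Walks {n : ℕ} {E : Rel (Fin n) 0ℓ} (E? : Decidable E) where

  length : ∀ {x z} → Star E x z → ℕ
  length ε       = zero
  length (_ ◅ w) = suc (length w)

  vertices : ∀ {x z} (w : Star E x z) → Fin (suc (length w)) → Fin n
  vertices {x} ε       _        = x
  vertices {x} (_ ◅ w) fzero    = x
  vertices     (_ ◅ w) (fsuc i) = vertices w i

  vertices-first : ∀ {x z} (w : Star E x z) → vertices w fzero ≡ x
  vertices-first ε       = refl
  vertices-first (_ ◅ w) = refl

  vertices-last : ∀ {x z} (w : Star E x z) → vertices w (fromℕ (length w)) ≡ z
  vertices-last ε       = refl
  vertices-last (_ ◅ w) = vertices-last w

  vertices-step : ∀ {x z} (w : Star E x z) (i : Fin (length w)) →
                  E (vertices w (inject₁ i)) (vertices w (fsuc i))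
  vertices-step {x} (e ◅ w) fzero    = subst (E x) (≡-sym (vertices-first w)) e
  vertices-step     (_ ◅ w) (fsuc i) = vertices-step w i

  _∈ᵥ_ : ∀ {x z} → Fin n → Star E x z → Set
  _∈ᵥ_ {x} v ε       = v ≡ x
  _∈ᵥ_ {x} v (_ ◅ w) = v ≡ x ⊎ v ∈ᵥ w

  _∈ᵥ?_ : ∀ {x z} v (w : Star E x z) → Dec (v ∈ᵥ w)
  _∈ᵥ?_ {x} v ε       = v ≟ x
  _∈ᵥ?_ {x} v (_ ◅ w) = (v ≟ x) ⊎-dec (v ∈ᵥ? w)

  vertices-∈ᵥ : ∀ {x z} (w : Star E x z) i → vertices w i ∈ᵥ w
  vertices-∈ᵥ ε       _        = refl
  vertices-∈ᵥ (_ ◅ w) fzero    = inj₁ refl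
  vertices-∈ᵥ (_ ◅ w) (fsuc i) = inj₂ (vertices-∈ᵥ w i)

  Simple : ∀ {x z} → Star E x z → Set
  Simple ε           = ⊤
  Simple {x} (_ ◅ w) = ¬ (x ∈ᵥ w) × Simple w

  SimpleWalk : Fin n → Fin n → Set
  SimpleWalk x z = Σ (Star E x z) Simple

  suffixFrom : ∀ {v x z} (w : Star E x z) → Simple w → v ∈ᵥ w → SimpleWalk v z
  suffixFrom ε       _       refl        = ε , tt
  suffixFrom (e ◅ w) simple  (inj₁ refl) = e ◅ w , simple
  suffixFrom (_ ◅ w) (_ , s) (inj₂ v∈w)  = suffixFrom w s v∈w

  shortcut : ∀ {x z} → Star E x z → SimpleWalk x z
  shortcut ε = ε , tt
  shortcut {x} (e ◅ w) with shortcut w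
  ... | w′ , s with x ∈ᵥ? w′
  ...   | yes x∈w′ = suffixFrom w′ s x∈w′
  ...   | no  x∉w′ = e ◅ w′ , x∉w′ , s

  vertices-injective : ∀ {x z} (w : Star E x z) → Simple w → Injective _≡_ _≡_ (vertices w)
  vertices-injective ε       _         {fzero}  {fzero}  _  = refl
  vertices-injective (_ ◅ w) _         {fzero}  {fzero}  _  = refl
  vertices-injective (_ ◅ w) (x∉w , _) {fzero}  {fsuc j} eq = contradiction (subst (_∈ᵥ w) (≡-sym eq) (vertices-∈ᵥ w j)) x∉w
  vertices-injective (_ ◅ w) (x∉w , _) {fsuc i} {fzero}  eq = contradiction (subst (_∈ᵥ w) eq (vertices-∈ᵥ w i)) x∉w
  vertices-injective (_ ◅ w) (_ , s)   {fsuc i} {fsuc j} eq = cong fsuc (vertices-injective w s eq)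

  simple-length< : ∀ {x z} (w : Star E x z) → Simple w → length w < n
  simple-length< w s = injective⇒≤ (vertices-injective w s)

  walkOfLength? : ∀ m x z → Dec (Σ (Star E x z) λ w → length w ≡ m)
  walkOfLength? zero x z with x ≟ z
  ... | yes refl = yes (ε , refl)
  ... | no  x≢z  = no λ { (ε , _) → x≢z refl ; (_ ◅ _ , ()) }
  walkOfLength? (suc m) x z with any? (λ y → E? x y ×-dec walkOfLength? m y z)
  ... | yes (_ , e , w , len≡m) = yes (e ◅ w , cong suc len≡m)
  ... | no  none = no λ { (ε , ()) ; (e ◅ w , len≡) → none (_ , e , w , suc-injective len≡) }

  walk? : ∀ x z → Dec (Star E x z)
  walk? x z with any? (λ (m : Fin n) → walkOfLength? (toℕ m) x z)
  ... | yes (_ , w , _) = yes w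
  ... | no  none        = no λ w →
    let (w′ , s) = shortcut w
        bound    = simple-length< w′ s
    in none (fromℕ< bound , w′ , ≡-sym (toℕ-fromℕ< bound))

module _ {n ℓ : ℕ} (G : Graph n) (p : PartialColoring n ℓ) (H : Subset n) where

  HEdge : Rel (Fin n) 0ℓ
  HEdge x y = Adj G x y × (x ∈ H ⊎ y ∈ H)

  HEdge? : Decidable HEdge
  HEdge? x y = adj? G x y ×-dec ((x ∈? H) ⊎-dec (y ∈? H))

  HEdge-sym : Symmetric HEdge
  HEdge-sym (xy , inj₁ x∈H) = sym G xy , inj₂ x∈H
  HEdge-sym (xy , inj₂ y∈H) = sym G xy , inj₁ y∈H

  open Walks HEdge?

  NoBadPath : Set
  NoBadPath = ¬ Σ (Path G) (BadPath G p H)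

  HappyOn : Coloring n ℓ → Set
  HappyOn c = ∀ v → v ∈ H → Happy G c v

  HappyOn⇒HEdge-monochromatic : ∀ {c} → HappyOn c → ∀ {x y} → HEdge x y → c x ≡ c y
  HappyOn⇒HEdge-monochromatic happy (xy , inj₁ x∈H) = ≡-sym (happy _ x∈H _ xy)
  HappyOn⇒HEdge-monochromatic happy (xy , inj₂ y∈H) = happy _ y∈H _ (sym G xy)

  HappyOn⇒NoBadPath : ∀ {c} → Extends c p → HappyOn c → NoBadPath
  HappyOn⇒NoBadPath {c} extends happy (P , (a , b , pa , pb , a≢b) , inH) =
    a≢b (trans (≡-sym (extends _ a pa)) (trans c-first≡c-last (extends _ b pb)))
    where
      c-first≡c-last : c (vertex P fzero) ≡ c (vertex P (fromℕ (k P)))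
      c-first≡c-last = first≡last (k P) (c ∘ vertex P)
        (λ i → HappyOn⇒HEdge-monochromatic happy (adjacent P i , inH i))

  simpleWalk⇒Path : ∀ {x z} (w : Star HEdge x z) → Simple w → Path G
  simpleWalk⇒Path w s = record
    { k        = length w
    ; vertex   = vertices w
    ; distinct = vertices-injective w s
    ; adjacent = proj₁ ∘ vertices-step w
    }

  NoBadPath⇒walk-consistent : NoBadPath → ∀ {s t a b} → Star HEdge s t →
                              p s ≡ just a → p t ≡ just b → a ≡ b
  NoBadPath⇒walk-consistent noBad {a = a} {b} w ps pt with a ≟ b
  ... | yes a≡b = a≡b
  ... | no  a≢b = ⊥-elim (noBad (simpleWalk⇒Path w′ s , ends , proj₂ ∘ vertices-step w′))
    where
      w′ = proj₁ (shortcut w)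
      s  = proj₂ (shortcut w)
      ends = a , b , trans (cong p (vertices-first w′)) ps , trans (cong p (vertices-last w′)) pt , a≢b

  Precoloured : Fin n → Set
  Precoloured s = ∃ λ a → p s ≡ just a

  precoloured? : ∀ s → Dec (Precoloured s)
  precoloured? s with p s
  ... | just a  = yes (a , refl)
  ... | nothing = no λ ()

  ReachesPrecoloured : Fin n → Set
  ReachesPrecoloured v = ∃ λ s → Precoloured s × Star HEdge v s

  reachesPrecoloured? : ∀ v → Dec (ReachesPrecoloured v)
  reachesPrecoloured? v = any? λ s → precoloured? s ×-dec walk? v s

  colourFrom : ∀ {v} → Fin ℓ → Dec (ReachesPrecoloured v) → Fin ℓ
  colourFrom _       (yes (_ , (a , _) , _)) = a
  colourFrom default (no _)                  = default

  reachColouring : Fin ℓ → Coloring n ℓ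
  reachColouring default v = colourFrom default (reachesPrecoloured? v)

  reachColouring-extends : NoBadPath → ∀ default → Extends (reachColouring default) p
  reachColouring-extends noBad default v a pv with reachesPrecoloured? v
  ... | yes (_ , (b , ps) , w) = ≡-sym (NoBadPath⇒walk-consistent noBad w pv ps)
  ... | no  unreachable        = contradiction (v , (a , pv) , ε) unreachable

  reachColouring-happy : NoBadPath → ∀ default → HappyOn (reachColouring default)
  reachColouring-happy noBad default v v∈H u vu with reachesPrecoloured? u | reachesPrecoloured? v
  ... | yes (_ , (_ , ps) , wu) | yes (_ , (_ , pt) , wv) =
        NoBadPath⇒walk-consistent noBad (reverse HEdge-sym wu ◅◅ (sym G vu , inj₂ v∈H) ◅ wv) ps pt
  ... | yes (s , cs , wu) | no unreachable = contradiction (s , cs , (vu , inj₁ v∈H) ◅ wu) unreachable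
  ... | no unreachable | yes (t , ct , wv) = contradiction (t , ct , (sym G vu , inj₂ v∈H) ◅ wv) unreachable
  ... | no _ | no _ = refl

lemma1 : (n ℓ : ℕ) → 1 ≤ ℓ → (G : Graph n) → (p : PartialColoring n ℓ) → (H : Subset n)
    → (∀ v → v ∈ H → PotentiallyHappy G p v)
    → (Σ (Coloring n ℓ) (λ c → Extends c p × (∀ v → v ∈ H → Happy G c v)))
      ⇔ (¬ Σ (Path G) (λ P → BadPath G p H P))
lemma1 n (suc _) _ G p H _ = mk⇔
  (λ (_ , extends , happy) → HappyOn⇒NoBadPath G p H extends happy)
  (λ noBad → reachColouring G p H fzero
           , reachColouring-extends G p H noBad fzero
           , reachColouring-happy G p H noBad fzero)
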